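{- Let $p$ be an odd prime and $r$ an integer with $1 \leq r \leq p-1$. Define $$A = \sum_{l=1}^{r}\sum_{j=1}^{l} (-1)^{r-l+1}\, l \binom{r}{l-j}\binom{p}{j},\qquad B = \sum_{l=r+1}^{p-1}\sum_{j=l-r}^{l} (-1)^{r-l+1}\, l \binom{r}{l-j}\binom{p}{j},$$ $$C = \sum_{l=1}^{r-1}\sum_{j=1}^{r-l} (-1)^{r-l}\, l \binom{r}{l+j}\binom{p}{j}.$$ Then $A + B + C \equiv 0 \pmod{p^2}$.
   Context: Empty sums are $0$; $\binom{n}{k}=0$ when $k<0$ or $k>n$. -}

module Defs where

open import Data.Nat using (ℕ; zero; suc; _∸_; _+_)
open import Data.Nat.Combinatorics using (_C_)
open import Data.Integer using (ℤ; +_; -_) renaming (_+_ to _+ℤ_; _*_ to _*ℤ_)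
open import Data.Integer using () renaming (_^_ to _^ℤ_)

-- ∑[ i ∈ a .. b ] f i  =  f a + f (a+1) + ⋯ + f b   (empty, i.e. 0, when b < a)
sumFrom : ℕ → ℕ → (ℕ → ℤ) → ℤ
sumFrom a zero f = + 0
sumFrom a (suc k) f = f a +ℤ sumFrom (suc a) k f

∑[_⋯_] : ℕ → ℕ → (ℕ → ℤ) → ℤ
∑[ a ⋯ b ] f = sumFrom a (suc b ∸ a) f

sgn : ℕ → ℤ
sgn e = (- (+ 1)) ^ℤ e

binom : ℕ → ℕ → ℤ
binom n k = + (n C k)

-- In A, 1 ≤ l ≤ r so the exponent r-l+1 is a natural number; also j ≤ l.
termA : ℕ → ℕ → ℕ → ℕ → ℤ
termA p r l j = sgn ((r ∸ l) + 1) *ℤ (+ l) *ℤ binom r (l ∸ j) *ℤ binom p j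

A : ℕ → ℕ → ℤ
A p r = ∑[ 1 ⋯ r ] (λ l → ∑[ 1 ⋯ l ] (λ j → termA p r l j))

-- In B, l ≥ r+1, so r-l+1 ≤ 0; (-1)^(r-l+1) = (-1)^(l-r-1) with l-r-1 ≥ 0.
B : ℕ → ℕ → ℤ
B p r = ∑[ r + 1 ⋯ p ∸ 1 ] (λ l → ∑[ l ∸ r ⋯ l ] (λ j →
          sgn (l ∸ r ∸ 1) *ℤ (+ l) *ℤ binom r (l ∸ j) *ℤ binom p j))

-- In C, 1 ≤ l ≤ r-1, so r-l ≥ 1.
C : ℕ → ℕ → ℤ
C p r = ∑[ 1 ⋯ r ∸ 1 ] (λ l → ∑[ 1 ⋯ r ∸ l ] (λ j →
          sgn (r ∸ l) *ℤ (+ l) *ℤ binom r (l + j) *ℤ binom p j))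

-- Vandermonde's convolution evaluates every inner sum:  Σ_{j ≥ 1} C(r, l−j) C(p, j) = C(r+p, l) − C(r, l).
-- The C(r, ·) contributions of A and C then cancel term by term (by the symmetry of C(r, ·)) and
-- that of B vanishes, so with n = r + p
--   A + B + C = (−1)^(r+1) Σ_{l=1}^{p−1} (−1)^l l C(n, l)  +  Σ_{k=0}^{r−1} (−1)^k (r−k) C(n, k).
-- Both sums reduce to partial alternating sums Σ_{k ≤ m} (−1)^k C(N+1, k) = (−1)^m C(N, m), the first
-- by absorption and the second by Abel summation.  For odd p they combine to the closed form
--   A + B + C = (−1)^(r−1) p C(p+r−1, r),
-- and r C(p+r−1, r) = p C(p+r−1, r−1) with p ∤ r shows that p divides the binomial coefficient.

module Submission where

open import Defs
open import Data.Nat using (ℕ; _≤_; _∸_; _^_)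
open import Data.Nat.Primality using (Prime)
open import Data.Integer using (+_) renaming (_+_ to _+ℤ_)
open import Data.Integer.Divisibility using () renaming (_∣_ to _∣ℤ_)
open import Relation.Binary.PropositionalEquality using (_≢_)

open import Data.Nat using (zero; suc; _<_; z≤n; s≤s)
open import Data.Nat.Combinatorics using (nCk+nC[k+1]≡[n+1]C[k+1]; k>n⇒nCk≡0; nCk≡nC[n∸k])
  renaming (_C_ to _choose_)
open import Data.Nat.Divisibility using (_∣_; _∣0; ∣-refl; ∣m∣n⇒∣m+n; ∣n⇒∣m*n; *-monoʳ-∣)
open import Data.Nat.Primality using (prime⇒irreducible)
open import Data.Sum using (inj₁; inj₂)
open import Relation.Nullary using (¬_; contradiction)
open import Relation.Binary.PropositionalEquality
open ≡-Reasoning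

module _ where
  open import Data.Nat using (_*_; _+_)
  open import Data.Nat.Properties using (*-zeroʳ; *-identityˡ; *-identityʳ; +-comm; *-comm; +-suc; m≤m+n; m+n∸m≡n; <⇒≱)
  open import Data.Nat.Combinatorics using (nC1≡n)
  open import Data.Nat.Divisibility using (divides; ∣⇒≤)
  open import Data.Nat.Primality using (euclidsLemma)
  open import Data.Nat.Tactic.RingSolver using (solve-∀)

  absorption : ∀ n k → suc k * (suc n choose suc k) ≡ suc n * (n choose k)
  absorption zero zero = refl
  absorption zero (suc k) = *-zeroʳ (suc (suc k))
  absorption (suc n) zero = trans (*-identityˡ (suc (suc n) choose 1)) (trans (nC1≡n (suc (suc n))) (sym (*-identityʳ (suc (suc n)))))
  absorption (suc n) (suc k) = begin
    suc (suc k) * (suc (suc n) choose suc (suc k))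
      ≡⟨ cong (suc (suc k) *_) (nCk+nC[k+1]≡[n+1]C[k+1] (suc n) (suc k)) ⟨
    suc (suc k) * (x + y) ≡⟨ expand (suc k) x y ⟩
    suc k * x + x + suc (suc k) * y ≡⟨ cong₂ (λ u v → u + x + v) (absorption n k) (absorption n (suc k)) ⟩
    suc n * (n choose k) + x + suc n * (n choose suc k) ≡⟨ collect (suc n) (n choose k) x (n choose suc k) ⟩
    suc n * ((n choose k) + (n choose suc k)) + x ≡⟨ cong (λ t → suc n * t + x) (nCk+nC[k+1]≡[n+1]C[k+1] n k) ⟩
    suc n * x + x ≡⟨ +-comm (suc n * x) x ⟩
    suc (suc n) * x ∎
    where
    x = suc n choose suc k
    y = suc n choose suc (suc k)
    expand : ∀ j x y → suc j * (x + y) ≡ j * x + x + suc j * y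
    expand = solve-∀
    collect : ∀ m u x v → m * u + x + m * v ≡ m * (u + v) + x
    collect = solve-∀

  choose-sym+ : ∀ a b → (a + b) choose a ≡ (a + b) choose b
  choose-sym+ a b = trans (nCk≡nC[n∸k] (m≤m+n a b)) (cong ((a + b) choose_) (m+n∸m≡n a b))

  [k+1]*[a+k+1]C[k+1]≡[a+1]*[a+k+1]Ck : ∀ a k → suc k * (suc (a + k) choose suc k) ≡ suc a * (suc (a + k) choose k)
  [k+1]*[a+k+1]C[k+1]≡[a+1]*[a+k+1]Ck a k = begin
    suc k * (suc (a + k) choose suc k) ≡⟨ absorption (a + k) k ⟩
    suc (a + k) * ((a + k) choose k) ≡⟨ cong (suc (a + k) *_) (choose-sym+ a k) ⟨
    suc (a + k) * ((a + k) choose a) ≡⟨ absorption (a + k) a ⟨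
    suc a * (suc (a + k) choose suc a) ≡⟨ cong (suc a *_) (choose-sym+ (suc a) k) ⟩
    suc a * (suc (a + k) choose k) ∎

  [q+s+3]*[q+s+1]Cq+[q+s+1]Cs≡[q+2]*[q+s+2]C[s+1] : ∀ q s →
    suc (suc (suc (q + s))) * (suc (q + s) choose q) + (suc (q + s) choose s) ≡ suc (suc q) * (suc (suc (q + s)) choose suc s)
  [q+s+3]*[q+s+1]Cq+[q+s+1]Cs≡[q+2]*[q+s+2]C[s+1] q s = begin
    suc (suc N) * (N choose q) + y ≡⟨ cong (λ t → suc (suc N) * t + y) NCq≡x ⟩
    suc (suc N) * x + y ≡⟨ split q s x y ⟩
    suc s * x + (suc (suc q) * x + y) ≡⟨ cong (_+ (suc (suc q) * x + y)) ([k+1]*[a+k+1]C[k+1]≡[a+1]*[a+k+1]Ck q s) ⟩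
    suc q * y + (suc (suc q) * x + y) ≡⟨ collect q x y ⟩
    suc (suc q) * (y + x) ≡⟨ cong (suc (suc q) *_) (nCk+nC[k+1]≡[n+1]C[k+1] N s) ⟩
    suc (suc q) * (suc N choose suc s) ∎
    where
    N = suc (q + s)
    x = N choose suc s
    y = N choose s
    NCq≡x : N choose q ≡ x
    NCq≡x = subst (λ n → n choose q ≡ n choose suc s) (+-suc q s) (choose-sym+ q (suc s))
    split : ∀ q s x y → suc (suc (suc (q + s))) * x + y ≡ suc s * x + (suc (suc q) * x + y)
    split = solve-∀
    collect : ∀ q x y → suc q * y + (suc (suc q) * x + y) ≡ suc (suc q) * (y + x)
    collect = solve-∀

  prime∣[p+s]C[s+1] : ∀ {p} s → Prime p → suc s < p → p ∣ (p + s) choose suc s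
  prime∣[p+s]C[s+1] {suc a} s prime-p s<p
    with euclidsLemma (suc s) ((suc a + s) choose suc s) prime-p
           (divides ((suc a + s) choose s) (trans ([k+1]*[a+k+1]C[k+1]≡[a+1]*[a+k+1]Ck a s) (*-comm (suc a) _)))
  ... | inj₁ p∣s+1 = contradiction (∣⇒≤ p∣s+1) (<⇒≱ s<p)
  ... | inj₂ p∣C = p∣C

import Data.Nat as ℕ
import Data.Nat.Properties as ℕ
open import Data.Integer using (ℤ; _+_; _*_; _-_; ∣_∣; 0ℤ; 1ℤ; -1ℤ)
import Data.Integer.Properties as ℤ
open import Data.Integer.Tactic.RingSolver using (solve-∀)

sumFrom-cong : ∀ a k {f g : ℕ → ℤ} → (∀ i → a ≤ i → i < a ℕ.+ k → f i ≡ g i) → sumFrom a k f ≡ sumFrom a k g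
sumFrom-cong a zero eq = refl
sumFrom-cong a (suc k) eq = cong₂ _+_ (eq a ℕ.≤-refl (ℕ.m<m+n a (s≤s z≤n)))
  (sumFrom-cong (suc a) k λ i a<i i<a+k → eq i (ℕ.<⇒≤ a<i) (ℕ.<-≤-trans i<a+k (ℕ.≤-reflexive (sym (ℕ.+-suc a k)))))

sumFrom-+ : ∀ a k (f g : ℕ → ℤ) → sumFrom a k (λ i → f i + g i) ≡ sumFrom a k f + sumFrom a k g
sumFrom-+ a zero f g = refl
sumFrom-+ a (suc k) f g = begin
  (f a + g a) + sumFrom (suc a) k (λ i → f i + g i) ≡⟨ cong (λ t → (f a + g a) + t) (sumFrom-+ (suc a) k f g) ⟩
  (f a + g a) + (sumFrom (suc a) k f + sumFrom (suc a) k g) ≡⟨ +-interchange (f a) (g a) _ _ ⟩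
  (f a + sumFrom (suc a) k f) + (g a + sumFrom (suc a) k g) ∎
  where
  +-interchange : ∀ w x y z → (w + x) + (y + z) ≡ (w + y) + (x + z)
  +-interchange = solve-∀

sumFrom-- : ∀ a k (f g : ℕ → ℤ) → sumFrom a k (λ i → f i - g i) ≡ sumFrom a k f - sumFrom a k g
sumFrom-- a zero f g = refl
sumFrom-- a (suc k) f g = begin
  (f a - g a) + sumFrom (suc a) k (λ i → f i - g i) ≡⟨ cong (λ t → (f a - g a) + t) (sumFrom-- (suc a) k f g) ⟩
  (f a - g a) + (sumFrom (suc a) k f - sumFrom (suc a) k g) ≡⟨ -‿interchange (f a) (g a) _ _ ⟩
  (f a + sumFrom (suc a) k f) - (g a + sumFrom (suc a) k g) ∎
  where
  -‿interchange : ∀ w x y z → (w - x) + (y - z) ≡ (w + y) - (x + z)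
  -‿interchange = solve-∀

sumFrom-*ˡ : ∀ a k c (f : ℕ → ℤ) → sumFrom a k (λ i → c * f i) ≡ c * sumFrom a k f
sumFrom-*ˡ a zero c f = sym (ℤ.*-zeroʳ c)
sumFrom-*ˡ a (suc k) c f = begin
  c * f a + sumFrom (suc a) k (λ i → c * f i) ≡⟨ cong (λ t → c * f a + t) (sumFrom-*ˡ (suc a) k c f) ⟩
  c * f a + c * sumFrom (suc a) k f ≡⟨ ℤ.*-distribˡ-+ c (f a) _ ⟨
  c * (f a + sumFrom (suc a) k f) ∎

sumFrom-zero : ∀ a k (f : ℕ → ℤ) → (∀ i → a ≤ i → i < a ℕ.+ k → f i ≡ 0ℤ) → sumFrom a k f ≡ 0ℤ
sumFrom-zero a k f f≡0 = trans (sumFrom-cong a k f≡0) (zeros a k)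
  where
  zeros : ∀ a k → sumFrom a k (λ _ → 0ℤ) ≡ 0ℤ
  zeros a zero = refl
  zeros a (suc k) = trans (ℤ.+-identityˡ _) (zeros (suc a) k)

sumFrom-++ : ∀ a k m (f : ℕ → ℤ) → sumFrom a (k ℕ.+ m) f ≡ sumFrom a k f + sumFrom (a ℕ.+ k) m f
sumFrom-++ a zero m f = begin
  sumFrom a m f ≡⟨ cong (λ b → sumFrom b m f) (ℕ.+-identityʳ a) ⟨
  sumFrom (a ℕ.+ 0) m f ≡⟨ ℤ.+-identityˡ _ ⟨
  0ℤ + sumFrom (a ℕ.+ 0) m f ∎
sumFrom-++ a (suc k) m f = begin
  f a + sumFrom (suc a) (k ℕ.+ m) f ≡⟨ cong (λ t → f a + t) (sumFrom-++ (suc a) k m f) ⟩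
  f a + (sumFrom (suc a) k f + sumFrom (suc a ℕ.+ k) m f) ≡⟨ ℤ.+-assoc (f a) _ _ ⟨
  (f a + sumFrom (suc a) k f) + sumFrom (suc a ℕ.+ k) m f ≡⟨ cong (λ b → sumFrom a (suc k) f + sumFrom b m f) (ℕ.+-suc a k) ⟨
  sumFrom a (suc k) f + sumFrom (a ℕ.+ suc k) m f ∎

sumFrom-last : ∀ a k (f : ℕ → ℤ) → sumFrom a (suc k) f ≡ sumFrom a k f + f (a ℕ.+ k)
sumFrom-last a k f = begin
  sumFrom a (suc k) f ≡⟨ cong (λ n → sumFrom a n f) (ℕ.+-comm 1 k) ⟩
  sumFrom a (k ℕ.+ 1) f ≡⟨ sumFrom-++ a k 1 f ⟩
  sumFrom a k f + (f (a ℕ.+ k) + 0ℤ) ≡⟨ cong (λ t → sumFrom a k f + t) (ℤ.+-identityʳ _) ⟩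
  sumFrom a k f + f (a ℕ.+ k) ∎

sumFrom-shift : ∀ a k (f : ℕ → ℤ) → sumFrom (suc a) k f ≡ sumFrom a k (λ i → f (suc i))
sumFrom-shift a zero f = refl
sumFrom-shift a (suc k) f = cong (λ t → f (suc a) + t) (sumFrom-shift (suc a) k f)

sumFrom-reverse : ∀ m (f : ℕ → ℤ) → sumFrom 1 m f ≡ sumFrom 0 m (λ i → f (m ∸ i))
sumFrom-reverse zero f = refl
sumFrom-reverse (suc m) f = begin
  sumFrom 1 (suc m) f ≡⟨ sumFrom-last 1 m f ⟩
  sumFrom 1 m f + f (suc m) ≡⟨ cong (_+ f (suc m)) (sumFrom-reverse m f) ⟩
  sumFrom 0 m (λ i → f (m ∸ i)) + f (suc m) ≡⟨ ℤ.+-comm _ (f (suc m)) ⟩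
  f (suc m) + sumFrom 0 m (λ i → f (m ∸ i)) ≡⟨ cong (λ t → f (suc m) + t) (sumFrom-shift 0 m (λ i → f (suc m ∸ i))) ⟨
  sumFrom 0 (suc m) (λ i → f (suc m ∸ i)) ∎

∑-split : ∀ {a b c} (f : ℕ → ℤ) → a ≤ b → b ≤ suc c → ∑[ a ⋯ c ] f ≡ sumFrom a (b ∸ a) f + ∑[ b ⋯ c ] f
∑-split {a} {b} {c} f a≤b b≤c+1 = begin
  sumFrom a (suc c ∸ a) f ≡⟨ cong (λ k → sumFrom a k f) count ⟩
  sumFrom a ((b ∸ a) ℕ.+ (suc c ∸ b)) f ≡⟨ sumFrom-++ a (b ∸ a) (suc c ∸ b) f ⟩
  sumFrom a (b ∸ a) f + sumFrom (a ℕ.+ (b ∸ a)) (suc c ∸ b) f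
    ≡⟨ cong (λ i → sumFrom a (b ∸ a) f + sumFrom i (suc c ∸ b) f) (ℕ.m+[n∸m]≡n a≤b) ⟩
  sumFrom a (b ∸ a) f + sumFrom b (suc c ∸ b) f ∎
  where
  count : suc c ∸ a ≡ (b ∸ a) ℕ.+ (suc c ∸ b)
  count = begin
    suc c ∸ a ≡⟨ cong (_∸ a) (ℕ.m+[n∸m]≡n b≤c+1) ⟨
    (b ℕ.+ (suc c ∸ b)) ∸ a ≡⟨ ℕ.+-∸-comm (suc c ∸ b) a≤b ⟩
    (b ∸ a) ℕ.+ (suc c ∸ b) ∎

∑-++ : ∀ {a b c} (f : ℕ → ℤ) → a ≤ suc b → b ≤ c → ∑[ a ⋯ b ] f + ∑[ b ℕ.+ 1 ⋯ c ] f ≡ ∑[ a ⋯ c ] f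
∑-++ {a} {b} {c} f a≤b+1 b≤c = begin
  ∑[ a ⋯ b ] f + ∑[ b ℕ.+ 1 ⋯ c ] f ≡⟨ cong (λ i → ∑[ a ⋯ b ] f + ∑[ i ⋯ c ] f) (ℕ.+-comm b 1) ⟩
  ∑[ a ⋯ b ] f + ∑[ suc b ⋯ c ] f ≡⟨ ∑-split f a≤b+1 (s≤s b≤c) ⟨
  ∑[ a ⋯ c ] f ∎

∑-drop-zeros : ∀ {a b c} (f : ℕ → ℤ) → a ≤ b → b ≤ suc c → (∀ i → a ≤ i → i < b → f i ≡ 0ℤ) →
               ∑[ b ⋯ c ] f ≡ ∑[ a ⋯ c ] f
∑-drop-zeros {a} {b} {c} f a≤b b≤c+1 zeros = sym (begin
  ∑[ a ⋯ c ] f ≡⟨ ∑-split f a≤b b≤c+1 ⟩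
  sumFrom a (b ∸ a) f + ∑[ b ⋯ c ] f ≡⟨ cong (_+ ∑[ b ⋯ c ] f) (sumFrom-zero a (b ∸ a) f (λ i a≤i i<a+[b-a] →
                                            zeros i a≤i (subst (i <_) (ℕ.m+[n∸m]≡n a≤b) i<a+[b-a]))) ⟩
  0ℤ + ∑[ b ⋯ c ] f ≡⟨ ℤ.+-identityˡ (∑[ b ⋯ c ] f) ⟩
  ∑[ b ⋯ c ] f ∎)

sgn-+ : ∀ a b → sgn (a ℕ.+ b) ≡ sgn a * sgn b
sgn-+ = ℤ.^-distribˡ-+-* -1ℤ

sgn-∸ : ∀ {a b} → b ≤ a → sgn (a ∸ b) ≡ sgn a * sgn b
sgn-∸ {a} z≤n = sym (ℤ.*-identityʳ (sgn a))
sgn-∸ {suc a} {suc b} (s≤s b≤a) = trans (sgn-∸ b≤a) (cancel (sgn a) (sgn b))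
  where
  cancel : ∀ x y → x * y ≡ (-1ℤ * x) * (-1ℤ * y)
  cancel = solve-∀

binom-pascal : ∀ n k → binom (suc n) (suc k) ≡ binom n k + binom n (suc k)
binom-pascal n k = trans (cong +_ (sym (nCk+nC[k+1]≡[n+1]C[k+1] n k))) (ℤ.pos-+ (n choose k) (n choose suc k))

binom-> : ∀ {n k} → n < k → binom n k ≡ 0ℤ
binom-> n<k = cong +_ (k>n⇒nCk≡0 n<k)

binom-sym : ∀ {n k} → k ≤ n → binom n k ≡ binom n (n ∸ k)
binom-sym k≤n = cong +_ (nCk≡nC[n∸k] k≤n)

vandermonde : ∀ r p m → sumFrom 0 (suc m) (λ j → binom r (m ∸ j) * binom p j) ≡ binom (r ℕ.+ p) m
vandermonde r zero m = begin
  binom r m * 1ℤ + sumFrom 1 m (λ j → binom r (m ∸ j) * binom 0 j)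
    ≡⟨ cong₂ _+_ (ℤ.*-identityʳ (binom r m)) (sumFrom-zero 1 m (λ j → binom r (m ∸ j) * binom 0 j) (λ j 1≤j _ →
         trans (cong (binom r (m ∸ j) *_) (binom-> 1≤j)) (ℤ.*-zeroʳ (binom r (m ∸ j))))) ⟩
  binom r m + 0ℤ ≡⟨ ℤ.+-identityʳ (binom r m) ⟩
  binom r m ≡⟨ cong (λ n → binom n m) (ℕ.+-identityʳ r) ⟨
  binom (r ℕ.+ 0) m ∎
vandermonde r (suc p) zero = refl
vandermonde r (suc p) (suc m) = begin
  binom r (suc m) * 1ℤ + sumFrom 1 (suc m) (λ j → binom r (suc m ∸ j) * binom (suc p) j)
    ≡⟨ cong (λ t → binom r (suc m) * 1ℤ + t) (sumFrom-shift 0 (suc m) (λ j → binom r (suc m ∸ j) * binom (suc p) j)) ⟩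
  binom r (suc m) * 1ℤ + sumFrom 0 (suc m) (λ j → binom r (m ∸ j) * binom (suc p) (suc j))
    ≡⟨ cong (λ t → binom r (suc m) * 1ℤ + t)
            (trans (sumFrom-cong 0 (suc m) (λ j _ _ → pascal-split j)) (sumFrom-+ 0 (suc m) low high)) ⟩
  binom r (suc m) * 1ℤ + (sumFrom 0 (suc m) low + sumFrom 0 (suc m) high)
    ≡⟨ regroup (binom r (suc m) * 1ℤ) (sumFrom 0 (suc m) low) (sumFrom 0 (suc m) high) ⟩
  sumFrom 0 (suc m) low + (binom r (suc m) * 1ℤ + sumFrom 0 (suc m) high)
    ≡⟨ cong (λ t → sumFrom 0 (suc m) low + (binom r (suc m) * 1ℤ + t))
            (sumFrom-shift 0 (suc m) (λ j → binom r (suc m ∸ j) * binom p j)) ⟨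
  sumFrom 0 (suc m) low + sumFrom 0 (suc (suc m)) (λ j → binom r (suc m ∸ j) * binom p j)
    ≡⟨ cong₂ _+_ (vandermonde r p m) (vandermonde r p (suc m)) ⟩
  binom (r ℕ.+ p) m + binom (r ℕ.+ p) (suc m) ≡⟨ binom-pascal (r ℕ.+ p) m ⟨
  binom (suc (r ℕ.+ p)) (suc m) ≡⟨ cong (λ n → binom n (suc m)) (ℕ.+-suc r p) ⟨
  binom (r ℕ.+ suc p) (suc m) ∎
  where
  low high : ℕ → ℤ
  low j = binom r (m ∸ j) * binom p j
  high j = binom r (m ∸ j) * binom p (suc j)
  pascal-split : ∀ j → binom r (m ∸ j) * binom (suc p) (suc j) ≡ low j + high j
  pascal-split j = trans (cong (binom r (m ∸ j) *_) (binom-pascal p j)) (ℤ.*-distribˡ-+ (binom r (m ∸ j)) (binom p j) (binom p (suc j)))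
  regroup : ∀ x y z → x + (y + z) ≡ y + (x + z)
  regroup = solve-∀

vandermonde-from-1 : ∀ r p m c → sumFrom 1 m (λ j → c * binom r (m ∸ j) * binom p j) ≡ c * (binom (r ℕ.+ p) m - binom r m)
vandermonde-from-1 r p m c = begin
  sumFrom 1 m (λ j → c * binom r (m ∸ j) * binom p j)
    ≡⟨ sumFrom-cong 1 m (λ j _ _ → ℤ.*-assoc c (binom r (m ∸ j)) (binom p j)) ⟩
  sumFrom 1 m (λ j → c * (binom r (m ∸ j) * binom p j)) ≡⟨ sumFrom-*ˡ 1 m c (λ j → binom r (m ∸ j) * binom p j) ⟩
  c * sumFrom 1 m (λ j → binom r (m ∸ j) * binom p j)
    ≡⟨ cong (c *_) (trans (drop-head (binom r m * 1ℤ) _) (cong₂ _-_ (vandermonde r p m) (ℤ.*-identityʳ (binom r m)))) ⟩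
  c * (binom (r ℕ.+ p) m - binom r m) ∎
  where
  drop-head : ∀ x s → s ≡ (x + s) - x
  drop-head = solve-∀

binom-absorption : ∀ n k → + suc k * binom (suc n) (suc k) ≡ + suc n * binom n k
binom-absorption n k = begin
  + suc k * binom (suc n) (suc k) ≡⟨ ℤ.pos-* (suc k) (suc n choose suc k) ⟨
  + (suc k ℕ.* (suc n choose suc k)) ≡⟨ cong +_ (absorption n k) ⟩
  + (suc n ℕ.* (n choose k)) ≡⟨ ℤ.pos-* (suc n) (n choose k) ⟩
  + suc n * binom n k ∎

alternating-sum : ∀ n m → sumFrom 0 (suc m) (λ k → sgn k * binom (suc n) k) ≡ sgn m * binom n m
alternating-sum n zero = refl
alternating-sum n (suc m) = begin
  sumFrom 0 (suc (suc m)) (λ k → sgn k * binom (suc n) k)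
    ≡⟨ sumFrom-last 0 (suc m) (λ k → sgn k * binom (suc n) k) ⟩
  sumFrom 0 (suc m) (λ k → sgn k * binom (suc n) k) + sgn (suc m) * binom (suc n) (suc m)
    ≡⟨ cong₂ (λ u v → u + sgn (suc m) * v) (alternating-sum n m) (binom-pascal n m) ⟩
  sgn m * binom n m + (-1ℤ * sgn m) * (binom n m + binom n (suc m)) ≡⟨ telescope (sgn m) (binom n m) (binom n (suc m)) ⟩
  sgn (suc m) * binom n (suc m) ∎
  where
  telescope : ∀ s x y → s * x + (-1ℤ * s) * (x + y) ≡ (-1ℤ * s) * y
  telescope = solve-∀

signed-moment : ∀ n m → sumFrom 1 (suc m) (λ k → sgn k * + k * binom (suc (suc n)) k) ≡ sgn (suc m) * (+ suc (suc n) * binom n m)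
signed-moment n m = begin
  sumFrom 1 (suc m) (λ k → sgn k * + k * binom (suc (suc n)) k)
    ≡⟨ sumFrom-shift 0 (suc m) (λ k → sgn k * + k * binom (suc (suc n)) k) ⟩
  sumFrom 0 (suc m) (λ k → sgn (suc k) * + suc k * binom (suc (suc n)) (suc k))
    ≡⟨ sumFrom-cong 0 (suc m) (λ k _ _ → absorb k) ⟩
  sumFrom 0 (suc m) (λ k → (-1ℤ * + suc (suc n)) * (sgn k * binom (suc n) k))
    ≡⟨ sumFrom-*ˡ 0 (suc m) (-1ℤ * + suc (suc n)) (λ k → sgn k * binom (suc n) k) ⟩
  (-1ℤ * + suc (suc n)) * sumFrom 0 (suc m) (λ k → sgn k * binom (suc n) k)
    ≡⟨ cong ((-1ℤ * + suc (suc n)) *_) (alternating-sum n m) ⟩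
  (-1ℤ * + suc (suc n)) * (sgn m * binom n m) ≡⟨ move-sign (+ suc (suc n)) (sgn m) (binom n m) ⟩
  sgn (suc m) * (+ suc (suc n) * binom n m) ∎
  where
  reassoc : ∀ s a b → (-1ℤ * s) * a * b ≡ -1ℤ * s * (a * b)
  reassoc = solve-∀
  move-sign : ∀ c s b → (-1ℤ * c) * (s * b) ≡ (-1ℤ * s) * (c * b)
  move-sign = solve-∀
  absorb : ∀ k → sgn (suc k) * + suc k * binom (suc (suc n)) (suc k) ≡ (-1ℤ * + suc (suc n)) * (sgn k * binom (suc n) k)
  absorb k = begin
    (-1ℤ * sgn k) * + suc k * binom (suc (suc n)) (suc k) ≡⟨ reassoc (sgn k) (+ suc k) (binom (suc (suc n)) (suc k)) ⟩
    -1ℤ * sgn k * (+ suc k * binom (suc (suc n)) (suc k)) ≡⟨ cong (-1ℤ * sgn k *_) (binom-absorption (suc n) k) ⟩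
    -1ℤ * sgn k * (+ suc (suc n) * binom (suc n) k) ≡⟨ move-sign' (sgn k) (+ suc (suc n)) (binom (suc n) k) ⟩
    (-1ℤ * + suc (suc n)) * (sgn k * binom (suc n) k) ∎
    where
    move-sign' : ∀ s c b → -1ℤ * s * (c * b) ≡ (-1ℤ * c) * (s * b)
    move-sign' = solve-∀

-- Abel summation: raising m by one adds a complete alternating sum.
weighted-alternating-sum : ∀ n m →
  sumFrom 0 (suc m) (λ k → sgn k * + (suc m ∸ k) * binom (suc (suc n)) k) ≡ sgn m * binom n m
weighted-alternating-sum n zero = refl
weighted-alternating-sum n (suc m) = begin
  sumFrom 0 (suc (suc m)) (λ k → sgn k * + (suc (suc m) ∸ k) * b k)
    ≡⟨ sumFrom-cong 0 (suc (suc m)) (λ k _ k<m+2 → peel k (ℕ.≤-pred k<m+2)) ⟩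
  sumFrom 0 (suc (suc m)) (λ k → w k + sgn k * b k) ≡⟨ sumFrom-+ 0 (suc (suc m)) w (λ k → sgn k * b k) ⟩
  sumFrom 0 (suc (suc m)) w + sumFrom 0 (suc (suc m)) (λ k → sgn k * b k)
    ≡⟨ cong₂ _+_ (sumFrom-last 0 (suc m) w) (alternating-sum (suc n) (suc m)) ⟩
  (sumFrom 0 (suc m) w + w (suc m)) + sgn (suc m) * binom (suc n) (suc m)
    ≡⟨ cong₂ (λ u v → (u + v) + sgn (suc m) * binom (suc n) (suc m)) (weighted-alternating-sum n m) last-weight-zero ⟩
  (sgn m * binom n m + 0ℤ) + sgn (suc m) * binom (suc n) (suc m)
    ≡⟨ cong (λ t → (sgn m * binom n m + 0ℤ) + sgn (suc m) * t) (binom-pascal n m) ⟩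
  (sgn m * binom n m + 0ℤ) + (-1ℤ * sgn m) * (binom n m + binom n (suc m)) ≡⟨ telescope (sgn m) (binom n m) (binom n (suc m)) ⟩
  sgn (suc m) * binom n (suc m) ∎
  where
  b : ℕ → ℤ
  b = binom (suc (suc n))
  w : ℕ → ℤ
  w k = sgn k * + (suc m ∸ k) * b k
  peel : ∀ k → k ≤ suc m → sgn k * + (suc (suc m) ∸ k) * b k ≡ w k + sgn k * b k
  peel k k≤m+1 = trans (cong (λ e → sgn k * + e * b k) (ℕ.+-∸-assoc 1 k≤m+1)) (distrib (sgn k) (+ (suc m ∸ k)) (b k))
    where
    distrib : ∀ s x c → s * (1ℤ + x) * c ≡ s * x * c + s * c
    distrib = solve-∀
  last-weight-zero : w (suc m) ≡ 0ℤ
  last-weight-zero = trans (cong (λ e → sgn (suc m) * + e * b (suc m)) (ℕ.n∸n≡0 m)) (zero-middle (sgn (suc m)) (b (suc m)))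
    where
    zero-middle : ∀ s c → s * 0ℤ * c ≡ 0ℤ
    zero-middle = solve-∀
  telescope : ∀ s x y → (s * x + 0ℤ) + (-1ℤ * s) * (x + y) ≡ (-1ℤ * s) * y
  telescope = solve-∀

A≡ : ∀ p r → A p r ≡ sumFrom 1 r (λ l → sgn (suc r) * (sgn l * + l * binom (r ℕ.+ p) l))
                   + sumFrom 1 r (λ l → sgn (r ∸ l) * + l * binom r l)
A≡ p r = begin
  A p r
    ≡⟨ sumFrom-cong 1 r (λ l _ l<r+1 → trans (vandermonde-from-1 r p l (sgn (r ∸ l ℕ.+ 1) * + l)) (split l (ℕ.≤-pred l<r+1))) ⟩
  sumFrom 1 r (λ l → sgn (suc r) * (sgn l * + l * binom (r ℕ.+ p) l) + sgn (r ∸ l) * + l * binom r l)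
    ≡⟨ sumFrom-+ 1 r (λ l → sgn (suc r) * (sgn l * + l * binom (r ℕ.+ p) l)) (λ l → sgn (r ∸ l) * + l * binom r l) ⟩
  sumFrom 1 r (λ l → sgn (suc r) * (sgn l * + l * binom (r ℕ.+ p) l)) + sumFrom 1 r (λ l → sgn (r ∸ l) * + l * binom r l) ∎
  where
  split : ∀ l → l ≤ r → sgn (r ∸ l ℕ.+ 1) * + l * (binom (r ℕ.+ p) l - binom r l)
                        ≡ sgn (suc r) * (sgn l * + l * binom (r ℕ.+ p) l) + sgn (r ∸ l) * + l * binom r l
  split l l≤r = begin
    sgn (r ∸ l ℕ.+ 1) * + l * (x - y)
      ≡⟨ cong (λ σ → σ * + l * (x - y)) (trans (sgn-+ (r ∸ l) 1) (cong (_* sgn 1) (sgn-∸ l≤r))) ⟩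
    sgn r * sgn l * sgn 1 * + l * (x - y) ≡⟨ expand (sgn r) (sgn l) (+ l) x y ⟩
    sgn (suc r) * (sgn l * + l * x) + sgn r * sgn l * + l * y
      ≡⟨ cong (λ σ → sgn (suc r) * (sgn l * + l * x) + σ * + l * y) (sgn-∸ l≤r) ⟨
    sgn (suc r) * (sgn l * + l * x) + sgn (r ∸ l) * + l * y ∎
    where
    x = binom (r ℕ.+ p) l
    y = binom r l
    expand : ∀ R L I x y → R * L * -1ℤ * I * (x - y) ≡ (-1ℤ * R) * (L * I * x) + R * L * I * y
    expand = solve-∀

B≡ : ∀ p r → B p r ≡ ∑[ r ℕ.+ 1 ⋯ p ∸ 1 ] (λ l → sgn (suc r) * (sgn l * + l * binom (r ℕ.+ p) l))
B≡ p r = sumFrom-cong (r ℕ.+ 1) (suc (p ∸ 1) ∸ (r ℕ.+ 1)) (λ l r+1≤l _ → inner l (subst (_≤ l) (ℕ.+-comm r 1) r+1≤l))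
  where
  inner : ∀ l → r < l → ∑[ l ∸ r ⋯ l ] (λ j → sgn (l ∸ r ∸ 1) * + l * binom r (l ∸ j) * binom p j)
                      ≡ sgn (suc r) * (sgn l * + l * binom (r ℕ.+ p) l)
  inner l r<l = begin
    ∑[ l ∸ r ⋯ l ] (λ j → c * binom r (l ∸ j) * binom p j)
      ≡⟨ ∑-drop-zeros (λ j → c * binom r (l ∸ j) * binom p j)
                      (ℕ.m<n⇒0<n∸m r<l) (ℕ.m≤n⇒m≤1+n (ℕ.m∸n≤m l r)) vanish ⟩
    sumFrom 1 l (λ j → c * binom r (l ∸ j) * binom p j) ≡⟨ vandermonde-from-1 r p l c ⟩
    c * (binom (r ℕ.+ p) l - binom r l) ≡⟨ cong (λ y → c * (binom (r ℕ.+ p) l - y)) (binom-> r<l) ⟩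
    c * (binom (r ℕ.+ p) l - 0ℤ) ≡⟨ cong (c *_) (ℤ.+-identityʳ (binom (r ℕ.+ p) l)) ⟩
    sgn (l ∸ r ∸ 1) * + l * binom (r ℕ.+ p) l
      ≡⟨ cong (λ σ → σ * + l * binom (r ℕ.+ p) l)
              (trans (sgn-∸ (ℕ.m<n⇒0<n∸m r<l)) (cong (_* sgn 1) (sgn-∸ (ℕ.<⇒≤ r<l)))) ⟩
    sgn l * sgn r * sgn 1 * + l * binom (r ℕ.+ p) l ≡⟨ regroup (sgn l) (sgn r) (+ l) (binom (r ℕ.+ p) l) ⟩
    sgn (suc r) * (sgn l * + l * binom (r ℕ.+ p) l) ∎
    where
    c = sgn (l ∸ r ∸ 1) * + l
    vanish : ∀ j → 1 ≤ j → j < l ∸ r → c * binom r (l ∸ j) * binom p j ≡ 0ℤ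
    vanish j _ j<l∸r = trans (cong (λ y → c * y * binom p j) (binom-> r<l∸j)) (zero-middle c (binom p j))
      where
      r<l∸j : r < l ∸ j
      r<l∸j = subst (_< l ∸ j) (ℕ.m∸[m∸n]≡n (ℕ.<⇒≤ r<l)) (ℕ.∸-monoʳ-< j<l∸r (ℕ.m∸n≤m l r))
      zero-middle : ∀ c b → c * 0ℤ * b ≡ 0ℤ
      zero-middle = solve-∀
    regroup : ∀ L R I N → L * R * -1ℤ * I * N ≡ (-1ℤ * R) * (L * I * N)
    regroup = solve-∀

C≡ : ∀ p r → C p r ≡ sumFrom 1 r (λ l → sgn (r ∸ l) * + l * binom (r ℕ.+ p) (r ∸ l))
                   - sumFrom 1 r (λ l → sgn (r ∸ l) * + l * binom r l)
C≡ p zero = refl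
C≡ p r@(suc s) = begin
  C p r ≡⟨ sumFrom-cong 1 s (λ l _ l<s+1 → inner l (ℕ.≤-trans (ℕ.≤-pred l<s+1) (ℕ.n≤1+n s))) ⟩
  sumFrom 1 s D ≡⟨ ℤ.+-identityʳ (sumFrom 1 s D) ⟨
  sumFrom 1 s D + 0ℤ ≡⟨ cong (λ t → sumFrom 1 s D + t) last-zero ⟨
  sumFrom 1 s D + D r ≡⟨ sumFrom-last 1 s D ⟨
  sumFrom 1 r D ≡⟨ sumFrom-cong 1 r (λ l _ l<r+1 → split l (ℕ.≤-pred l<r+1)) ⟩
  sumFrom 1 r (λ l → N l - R l) ≡⟨ sumFrom-- 1 r N R ⟩
  sumFrom 1 r N - sumFrom 1 r R ∎
  where
  n = r ℕ.+ p
  c : ℕ → ℤ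
  c l = sgn (r ∸ l) * + l
  D N R : ℕ → ℤ
  D l = c l * (binom n (r ∸ l) - binom r (r ∸ l))
  N l = c l * binom n (r ∸ l)
  R l = c l * binom r l
  inner : ∀ l → l ≤ r → sumFrom 1 (r ∸ l) (λ j → c l * binom r (l ℕ.+ j) * binom p j) ≡ D l
  inner l l≤r =
    trans (sumFrom-cong 1 (r ∸ l) (λ j _ j<1+[r-l] → cong (λ y → c l * y * binom p j) (reflect j (ℕ.≤-pred j<1+[r-l]))))
          (vandermonde-from-1 r p (r ∸ l) (c l))
    where
    reflect : ∀ j → j ≤ r ∸ l → binom r (l ℕ.+ j) ≡ binom r (r ∸ l ∸ j)
    reflect j j≤r-l = trans (binom-sym l+j≤r) (cong (binom r) (sym (ℕ.∸-+-assoc r l j)))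
      where
      l+j≤r : l ℕ.+ j ≤ r
      l+j≤r = subst (l ℕ.+ j ≤_) (ℕ.m+[n∸m]≡n l≤r) (ℕ.+-monoʳ-≤ l j≤r-l)
  last-zero : D r ≡ 0ℤ
  last-zero = trans (cong (λ e → sgn e * + r * (binom n e - binom r e)) (ℕ.n∸n≡0 s)) (ℤ.*-zeroʳ (1ℤ * + r))
  split : ∀ l → l ≤ r → D l ≡ N l - R l
  split l l≤r = trans (cong (λ y → c l * (binom n (r ∸ l) - y)) (sym (binom-sym l≤r))) (distrib (c l) (binom n (r ∸ l)) (binom r l))
    where
    distrib : ∀ c x y → c * (x - y) ≡ c * x - c * y
    distrib = solve-∀

A+B+C≡ : ∀ p r → r ≤ p ∸ 1 → A p r +ℤ B p r +ℤ C p r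
       ≡ sgn (suc r) * ∑[ 1 ⋯ p ∸ 1 ] (λ l → sgn l * + l * binom (r ℕ.+ p) l)
         + sumFrom 1 r (λ l → sgn (r ∸ l) * + l * binom (r ℕ.+ p) (r ∸ l))
A+B+C≡ p r r≤p-1 = begin
  A p r + B p r + C p r ≡⟨ cong₂ _+_ (cong₂ _+_ (A≡ p r) (B≡ p r)) (C≡ p r) ⟩
  (SA + R) + SB + (Z - R) ≡⟨ cancel SA R SB Z ⟩
  (SA + SB) + Z ≡⟨ cong (_+ Z) (∑-++ (λ l → sgn (suc r) * T l) (s≤s z≤n) r≤p-1) ⟩
  ∑[ 1 ⋯ p ∸ 1 ] (λ l → sgn (suc r) * T l) + Z ≡⟨ cong (_+ Z) (sumFrom-*ˡ 1 (p ∸ 1) (sgn (suc r)) T) ⟩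
  sgn (suc r) * ∑[ 1 ⋯ p ∸ 1 ] T + Z ∎
  where
  T : ℕ → ℤ
  T l = sgn l * + l * binom (r ℕ.+ p) l
  SA = sumFrom 1 r (λ l → sgn (suc r) * T l)
  SB = ∑[ r ℕ.+ 1 ⋯ p ∸ 1 ] (λ l → sgn (suc r) * T l)
  R = sumFrom 1 r (λ l → sgn (r ∸ l) * + l * binom r l)
  Z = sumFrom 1 r (λ l → sgn (r ∸ l) * + l * binom (r ℕ.+ p) (r ∸ l))
  cancel : ∀ a r b z → (a + r) + b + (z - r) ≡ (a + b) + z
  cancel = solve-∀

closed-form : ∀ {p r} → sgn p ≡ -1ℤ → 1 ≤ r → r ≤ p ∸ 1 →
  A p r +ℤ B p r +ℤ C p r ≡ sgn (r ∸ 1) * + (p ℕ.* ((p ℕ.+ (r ∸ 1)) choose r))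
closed-form {p@(suc (suc q))} {r@(suc s)} p-odd _ (s≤s s≤q) = begin
  A p r + B p r + C p r ≡⟨ A+B+C≡ p r (s≤s s≤q) ⟩
  sgn (suc r) * X (r ℕ.+ p) + Z (r ℕ.+ p) ≡⟨ cong (λ m → sgn (suc r) * X m + Z m) n≡N+2 ⟩
  sgn (suc r) * X (suc (suc N)) + Z (suc (suc N)) ≡⟨ cong₂ (λ u v → sgn (suc r) * u + v) (signed-moment N q) Z-closed ⟩
  sgn (suc r) * (sgn (suc q) * (+ suc (suc N) * binom N q)) + sgn s * binom N s
    ≡⟨ cong (λ σ → sgn (suc r) * (σ * (+ suc (suc N) * binom N q)) + sgn s * binom N s) sgn[q+1]≡1 ⟩
  sgn (suc r) * (1ℤ * (+ suc (suc N) * binom N q)) + sgn s * binom N s ≡⟨ factor (sgn s) (+ suc (suc N) * binom N q) (binom N s) ⟩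
  sgn s * (+ suc (suc N) * binom N q + binom N s) ≡⟨ cong (sgn s *_) cast ⟨
  sgn s * + (suc (suc N) ℕ.* (N choose q) ℕ.+ (N choose s))
    ≡⟨ cong (λ t → sgn s * + t) ([q+s+3]*[q+s+1]Cq+[q+s+1]Cs≡[q+2]*[q+s+2]C[s+1] q s) ⟩
  sgn s * + (p ℕ.* (suc N choose suc s)) ∎
  where
  N = suc (q ℕ.+ s)
  X Z : ℕ → ℤ
  X m = sumFrom 1 (suc q) (λ l → sgn l * + l * binom m l)
  Z m = sumFrom 1 r (λ l → sgn (r ∸ l) * + l * binom m (r ∸ l))
  n≡N+2 : r ℕ.+ p ≡ suc (suc N)
  n≡N+2 = cong suc (trans (ℕ.+-suc s (suc q)) (cong suc (trans (ℕ.+-suc s q) (cong suc (ℕ.+-comm s q)))))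
  Z-closed : Z (suc (suc N)) ≡ sgn s * binom N s
  Z-closed = begin
    Z (suc (suc N)) ≡⟨ sumFrom-reverse r (λ l → sgn (r ∸ l) * + l * binom (suc (suc N)) (r ∸ l)) ⟩
    sumFrom 0 r (λ i → sgn (r ∸ (r ∸ i)) * + (r ∸ i) * binom (suc (suc N)) (r ∸ (r ∸ i)))
      ≡⟨ sumFrom-cong 0 r (λ i _ i<r → cong (λ j → sgn j * + (r ∸ i) * binom (suc (suc N)) j)
                                             (ℕ.m∸[m∸n]≡n (ℕ.<⇒≤ i<r))) ⟩
    sumFrom 0 r (λ i → sgn i * + (r ∸ i) * binom (suc (suc N)) i) ≡⟨ weighted-alternating-sum N s ⟩
    sgn s * binom N s ∎
  -- the only place where p is odd is used
  sgn[q+1]≡1 : sgn (suc q) ≡ 1ℤ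
  sgn[q+1]≡1 = trans (double-negation (sgn (suc q))) (cong (-1ℤ *_) p-odd)
    where
    double-negation : ∀ x → x ≡ -1ℤ * (-1ℤ * x)
    double-negation = solve-∀
  factor : ∀ σ u v → (-1ℤ * (-1ℤ * σ)) * (1ℤ * u) + σ * v ≡ σ * (u + v)
  factor = solve-∀
  cast : + (suc (suc N) ℕ.* (N choose q) ℕ.+ (N choose s)) ≡ + suc (suc N) * binom N q + binom N s
  cast = trans (ℤ.pos-+ (suc (suc N) ℕ.* (N choose q)) (N choose s)) (cong (_+ binom N s) (ℤ.pos-* (suc (suc N)) (N choose q)))

sgn-odd : ∀ m → ¬ 2 ∣ m → sgn m ≡ -1ℤ
sgn-odd zero 2∤0 = contradiction (2 ∣0) 2∤0
sgn-odd (suc zero) _ = refl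
sgn-odd (suc (suc m)) 2∤m+2 = trans (double-negation (sgn m)) (sgn-odd m (λ 2∣m → 2∤m+2 (∣m∣n⇒∣m+n ∣-refl 2∣m)))
  where
  double-negation : ∀ x → -1ℤ * (-1ℤ * x) ≡ x
  double-negation = solve-∀

odd-prime : ∀ {p} → Prime p → p ≢ 2 → ¬ 2 ∣ p
odd-prime prime-p p≢2 2∣p with prime⇒irreducible prime-p 2∣p
... | inj₁ ()
... | inj₂ 2≡p = p≢2 (sym 2≡p)

∣ℤ-*ˡ : ∀ σ {d x} → d ∣ℤ x → d ∣ℤ σ * x
∣ℤ-*ˡ σ {d} {x} d∣x = subst (λ y → ∣ d ∣ ∣ y) (sym (ℤ.abs-* σ x)) (∣n⇒∣m*n ∣ σ ∣ d∣x)

proposition3p3 : (p r : ℕ) → Prime p → p ≢ 2 → 1 ≤ r → r ≤ p ∸ 1 →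
    (+ (p ^ 2)) ∣ℤ (A p r +ℤ B p r +ℤ C p r)
proposition3p3 p@(suc _) r@(suc s) prime-p p≢2 1≤r r≤p-1 =
  subst (+ (p ^ 2) ∣ℤ_) (sym (closed-form p-odd 1≤r r≤p-1)) (∣ℤ-*ˡ (sgn s) {+ (p ^ 2)} p²∣p*C)
  where
  p-odd : sgn p ≡ -1ℤ
  p-odd = sgn-odd p (odd-prime prime-p p≢2)
  p²∣p*C : + (p ^ 2) ∣ℤ + (p ℕ.* ((p ℕ.+ s) choose r))
  p²∣p*C = *-monoʳ-∣ p (subst (_∣ (p ℕ.+ s) choose r) (sym (ℕ.*-identityʳ p)) (prime∣[p+s]C[s+1] s prime-p (s≤s r≤p-1)))
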